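{- Let $S$ be a sandpile with sink $s$, let $v,w\in V_o$ with $\pi_w(v)>0$, let $x'_v$ be the minimum number of particles that must be added at $v$, starting from the empty configuration, so that $w$ topples at least once during the relaxation, and let $h:V_o\to\mathbb{N}$ be the stable configuration obtained by adding $x'_v$ particles at $v$ to the empty configuration and relaxing. Then $$x'_v\ge\frac{1}{\pi_w(v)}\sum_{u\in V_o}h(u)\,\pi_w(u).$$
   Context: A sandpile is a finite connected multigraph $G$ with distinguished sink vertex $s$; $V_o=V(G)\setminus\{s\}$; $d(u)$ is the degree counting multiplicities. A configuration $c:V_o\to\mathbb{N}$ is unstable at $u$ if $c(u)\ge d(u)$; toppling $u$ sends one particle along each edge at $u$ (particles reaching $s$ disappear); the sink never topples; every configuration relaxes to a unique stable configuration. For $w\in V_o$, $\pi_w$ is the function with $\pi_w(s)=0$, $\pi_w(w)=1$, harmonic at all other vertices (weighted by edge multiplicities); equivalently $\pi_w(u)$ is the probability that simple random walk from $u$ hits $w$ before $s$. -}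

module Defs where

open import Data.Nat as ℕ using (ℕ; zero; suc; _≤_; _<_)
open import Data.Integer using (+_)
open import Data.Rational as ℚ using (ℚ; 0ℚ; _/_)
open import Data.Fin using (Fin; zero; suc; _≟_)
open import Data.List using (List; []; _∷_)
open import Data.List.Membership.Propositional using (_∈_)
open import Data.Product using (Σ; _×_; ∃; ∃-syntax)
open import Relation.Nullary using (¬_; yes; no)
open import Relation.Binary.PropositionalEquality using (_≡_; _≢_)

-- A multigraph on vertex set Fin n, given by its (symmetric) matrix of
-- edge multiplicities: A u v = number of edges between u and v.
Multigraph : ℕ → Set
Multigraph n = Fin n → Fin n → ℕ

∑ℕ : ∀ {n} → (Fin n → ℕ) → ℕ
∑ℕ {zero}  f = 0
∑ℕ {suc n} f = f zero ℕ.+ ∑ℕ (λ i → f (suc i))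

∑ℚ : ∀ {n} → (Fin n → ℚ) → ℚ
∑ℚ {zero}  f = 0ℚ
∑ℚ {suc n} f = f zero ℚ.+ ∑ℚ (λ i → f (suc i))

ℕtoℚ : ℕ → ℚ
ℕtoℚ k = (+ k) / 1

Symmetric : ∀ {n} → Multigraph n → Set
Symmetric A = ∀ u v → A u v ≡ A v u

data Reach {n} (A : Multigraph n) (u : Fin n) : Fin n → Set where
  here : Reach A u u
  step : ∀ {v t} → Reach A u v → 0 < A v t → Reach A u t

Connected : ∀ {n} → Multigraph n → Set
Connected A = ∀ u v → Reach A u v

deg : ∀ {n} → Multigraph n → Fin n → ℕ
deg A u = ∑ℕ (λ v → A u v)

-- configurations (value at the sink is kept at 0: particles reaching
-- the sink disappear)
Config : ℕ → Set
Config n = Fin n → ℕ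

single : ∀ {n} → Fin n → ℕ → Config n
single v k u with u ≟ v
... | yes _ = k
... | no  _ = 0

-- toppling vertex u (used only when u ≢ s and deg A u ≤ c u)
topple : ∀ {n} → Multigraph n → (s : Fin n) → Fin n → Config n → Config n
topple A s u c v with v ≟ s | v ≟ u
... | yes _ | _     = c v
... | no  _ | yes _ = (c v ℕ.+ A u v) ℕ.∸ deg A u
... | no  _ | no  _ = c v ℕ.+ A u v

data Legal {n} (A : Multigraph n) (s : Fin n) : Config n → List (Fin n) → Config n → Set where
  done : ∀ {c} → Legal A s c [] c
  top  : ∀ {c u us c'} → u ≢ s → deg A u ≤ c u →
         Legal A s (topple A s u c) us c' → Legal A s c (u ∷ us) c'

Stable : ∀ {n} → Multigraph n → Fin n → Config n → Set
Stable A s c = ∀ u → u ≢ s → c u < deg A u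

RelaxesVia : ∀ {n} → Multigraph n → Fin n → Config n → List (Fin n) → Config n → Set
RelaxesVia A s c us c' = Legal A s c us c' × Stable A s c'

ToppleDuring : ∀ {n} → Multigraph n → Fin n → Config n → Fin n → Set
ToppleDuring A s c w = ∃[ us ] ∃[ c' ] (RelaxesVia A s c us c' × w ∈ us)

IsHittingProb : ∀ {n} → Multigraph n → Fin n → Fin n → (Fin n → ℚ) → Set
IsHittingProb A s w π =
  (π s ≡ 0ℚ) × (π w ≡ ℚ.1ℚ) ×
  (∀ u → u ≢ s → u ≢ w →
     ℕtoℚ (deg A u) ℚ.* π u ≡ ∑ℚ (λ v → ℕtoℚ (A u v) ℚ.* π v))

weightedSum : ∀ {n} → Fin n → Config n → (Fin n → ℚ) → ℚ
weightedSum s h π = ∑ℚ (λ u → f u)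
  where
  f : _ → ℚ
  f u with u ≟ s
  ... | yes _ = 0ℚ
  ... | no  _ = ℕtoℚ (h u) ℚ.* π u

-- The potential ⟨ c ∣ π ⟩ = Σ c(u) π(u) never increases along a legal toppling sequence:
-- toppling u changes it by Σ_t A(u,t) π(t) − d(u) π(u), which is 0 at vertices where π is
-- harmonic and ≤ 0 at w, because π ≤ 1 = π(w) by the maximum principle (this is where
-- connectedness enters).  Hence ⟨ h ∣ π ⟩ ≤ ⟨ x·1_v ∣ π ⟩ = x π(v).
module Submission where

open import Defs
open import Data.Nat as ℕ using (ℕ; zero; suc; _<_)
import Data.Nat.Properties as ℕ
import Data.Nat.Coprimality as Coprimality
open import Data.Fin using (Fin; zero; suc; _≟_)
import Data.Fin.Properties as Fin
import Data.Integer as ℤ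
import Data.Integer.Properties as ℤₚ
open import Data.List using (List)
open import Data.Rational
  using (ℚ; mkℚ; 0ℚ; 1ℚ; _≤_; _+_; _-_; -_; _*_; Positive)
  renaming (_<_ to _<ℚ_)
open import Data.Rational.Properties hiding (_≟_)
open import Data.Rational.Solver using (module +-*-Solver)
open import Data.Product using (∃; _,_)
open import Data.Sum using (inj₁; inj₂)
open import Function using (_∘_)
open import Relation.Nullary using (¬_; Dec; yes; no; contradiction)
open import Relation.Binary.PropositionalEquality
  using (_≡_; _≢_; refl; sym; trans; cong; cong₂; subst; module ≡-Reasoning)

private
  variable
    n : ℕ

+-cancelʳ-≤ : ∀ {a b} c → a + c ≤ b + c → a ≤ b
+-cancelʳ-≤ {a} {b} c a+c≤b+c = begin
  a              ≡⟨ +-∸ a c ⟩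
  (a + c) - c    ≤⟨ +-monoˡ-≤ (- c) a+c≤b+c ⟩
  (b + c) - c    ≡⟨ sym (+-∸ b c) ⟩
  b              ∎
  where
  open ≤-Reasoning
  open +-*-Solver
  +-∸ : ∀ a c → a ≡ (a + c) - c
  +-∸ = solve 2 (λ a c → a := (a :+ c) :- c) refl

ℕtoℚ≡mkℚ : ∀ k → ℕtoℚ k ≡ mkℚ (ℤ.+ k) 0 (Coprimality.sym (Coprimality.1-coprimeTo k))
ℕtoℚ≡mkℚ k = normalize-coprime (Coprimality.sym (Coprimality.1-coprimeTo k))

ℕtoℚ-+ : ∀ a b → ℕtoℚ (a ℕ.+ b) ≡ ℕtoℚ a + ℕtoℚ b
ℕtoℚ-+ a b
  rewrite ℕtoℚ≡mkℚ a | ℕtoℚ≡mkℚ b | ℤₚ.*-identityʳ (ℤ.+ a) | ℤₚ.*-identityʳ (ℤ.+ b) = refl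

ℕtoℚ-+-scaled : ∀ a b c d p → a ℕ.+ b ≡ c ℕ.+ d →
                ℕtoℚ a * p + ℕtoℚ b * p ≡ ℕtoℚ c * p + ℕtoℚ d * p
ℕtoℚ-+-scaled a b c d p a+b≡c+d = begin
  ℕtoℚ a * p + ℕtoℚ b * p     ≡⟨ sym (*-distribʳ-+ p (ℕtoℚ a) (ℕtoℚ b)) ⟩
  (ℕtoℚ a + ℕtoℚ b) * p       ≡⟨ cong (_* p) (sym (ℕtoℚ-+ a b)) ⟩
  ℕtoℚ (a ℕ.+ b) * p          ≡⟨ cong (λ z → ℕtoℚ z * p) a+b≡c+d ⟩
  ℕtoℚ (c ℕ.+ d) * p          ≡⟨ cong (_* p) (ℕtoℚ-+ c d) ⟩
  (ℕtoℚ c + ℕtoℚ d) * p       ≡⟨ *-distribʳ-+ p (ℕtoℚ c) (ℕtoℚ d) ⟩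
  ℕtoℚ c * p + ℕtoℚ d * p     ∎
  where open ≡-Reasoning

ℕtoℚ-∑ℕ : (f : Fin n → ℕ) → ℕtoℚ (∑ℕ f) ≡ ∑ℚ (ℕtoℚ ∘ f)
ℕtoℚ-∑ℕ {zero}  f = refl
ℕtoℚ-∑ℕ {suc n} f = trans (ℕtoℚ-+ (f zero) _) (cong (ℕtoℚ (f zero) +_) (ℕtoℚ-∑ℕ (f ∘ suc)))

ℕtoℚ-*-monoˡ-≤ : ∀ k {p q} → p ≤ q → ℕtoℚ k * p ≤ ℕtoℚ k * q
ℕtoℚ-*-monoˡ-≤ k = *-monoˡ-≤-nonNeg (ℕtoℚ k) {{normalize-nonNeg k 1}}

ℕtoℚ-pos : ∀ {k} → 0 < k → Positive (ℕtoℚ k)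
ℕtoℚ-pos {suc k} _ = normalize-pos (suc k) 1

∑ℚ-cong : {f g : Fin n → ℚ} → (∀ u → f u ≡ g u) → ∑ℚ f ≡ ∑ℚ g
∑ℚ-cong {zero}  f≡g = refl
∑ℚ-cong {suc n} f≡g = cong₂ _+_ (f≡g zero) (∑ℚ-cong (f≡g ∘ suc))

∑ℚ-+ : (f g : Fin n → ℚ) → ∑ℚ (λ u → f u + g u) ≡ ∑ℚ f + ∑ℚ g
∑ℚ-+ {zero}  f g = refl
∑ℚ-+ {suc n} f g rewrite ∑ℚ-+ (f ∘ suc) (g ∘ suc) =
  middleFour (f zero) (g zero) (∑ℚ (f ∘ suc)) (∑ℚ (g ∘ suc))
  where
  open +-*-Solver
  middleFour : ∀ a b c d → (a + b) + (c + d) ≡ (a + c) + (b + d)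
  middleFour = solve 4 (λ a b c d → (a :+ b) :+ (c :+ d) := (a :+ c) :+ (b :+ d)) refl

∑ℚ-*ʳ : (f : Fin n → ℚ) (c : ℚ) → ∑ℚ (λ u → f u * c) ≡ ∑ℚ f * c
∑ℚ-*ʳ {zero}  f c = sym (*-zeroˡ c)
∑ℚ-*ʳ {suc n} f c rewrite ∑ℚ-*ʳ (f ∘ suc) c = sym (*-distribʳ-+ c (f zero) _)

∑ℚ-mono-≤ : {f g : Fin n → ℚ} → (∀ u → f u ≤ g u) → ∑ℚ f ≤ ∑ℚ g
∑ℚ-mono-≤ {zero}  f≤g = ≤-refl
∑ℚ-mono-≤ {suc n} f≤g = +-mono-≤ (f≤g zero) (∑ℚ-mono-≤ (f≤g ∘ suc))

∑ℚ-mono-< : {f g : Fin n → ℚ} → (∀ u → f u ≤ g u) → ∀ t → f t <ℚ g t → ∑ℚ f <ℚ ∑ℚ g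
∑ℚ-mono-< {suc n} f≤g zero    ft<gt = +-mono-<-≤ ft<gt (∑ℚ-mono-≤ (f≤g ∘ suc))
∑ℚ-mono-< {suc n} f≤g (suc t) ft<gt = +-mono-≤-< (f≤g zero) (∑ℚ-mono-< (f≤g ∘ suc) t ft<gt)

∑ℚ-zero : (f : Fin n → ℚ) → (∀ u → f u ≡ 0ℚ) → ∑ℚ f ≡ 0ℚ
∑ℚ-zero {zero}  f f≡0 = refl
∑ℚ-zero {suc n} f f≡0 rewrite f≡0 zero | ∑ℚ-zero (f ∘ suc) (f≡0 ∘ suc) = refl

∑ℚ-supported-at : ∀ (v : Fin n) (f : Fin n → ℚ) → (∀ u → u ≢ v → f u ≡ 0ℚ) → ∑ℚ f ≡ f v
∑ℚ-supported-at {suc n} zero f f≡0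
  rewrite ∑ℚ-zero (f ∘ suc) (λ u → f≡0 (suc u) λ ()) = +-identityʳ (f zero)
∑ℚ-supported-at {suc n} (suc v) f f≡0 rewrite f≡0 zero (λ ()) =
  trans (+-identityˡ _)
        (∑ℚ-supported-at v (f ∘ suc) (λ u u≢v → f≡0 (suc u) (u≢v ∘ Fin.suc-injective)))

IsMax : (Fin n → ℚ) → Fin n → Set
IsMax f m = ∀ u → f u ≤ f m

argmax : Fin n → (f : Fin n → ℚ) → ∃ (IsMax f)
argmax {suc zero}    _ f = zero , λ { zero → ≤-refl }
argmax {suc (suc n)} _ f with argmax zero (f ∘ suc)
... | m , max with ≤-total (f zero) (f (suc m))
...   | inj₁ f0≤fm = suc m , λ { zero → f0≤fm ; (suc u) → max u }
...   | inj₂ fm≤f0 = zero  , λ { zero → ≤-refl ; (suc u) → ≤-trans (max u) fm≤f0 }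

module _ (A : Multigraph n) where

  Harmonic : (Fin n → ℚ) → Fin n → Set
  Harmonic f u = ℕtoℚ (deg A u) * f u ≡ ∑ℚ (λ t → ℕtoℚ (A u t) * f t)

  Superharmonic : (Fin n → ℚ) → Fin n → Set
  Superharmonic f u = ∑ℚ (λ t → ℕtoℚ (A u t) * f t) ≤ ℕtoℚ (deg A u) * f u

  ∑-edges-const : ∀ u c → ∑ℚ (λ t → ℕtoℚ (A u t) * c) ≡ ℕtoℚ (deg A u) * c
  ∑-edges-const u c = trans (∑ℚ-*ʳ (ℕtoℚ ∘ A u) c) (cong (_* c) (sym (ℕtoℚ-∑ℕ (A u))))

  harmonic-max-neighbour : ∀ {f m u t} → IsMax f m → Harmonic f u → f u ≡ f m →
                           0 < A u t → f t ≡ f m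
  harmonic-max-neighbour {f} {m} {u} {t} max harm fu≡fm 0<Aut =
    ≤-antisym (max t) (≮⇒≥ λ ft<fm → <-irrefl refl (begin-strict
      ∑ℚ (λ x → ℕtoℚ (A u x) * f x)   <⟨ ∑ℚ-mono-<
                                           (λ x → ℕtoℚ-*-monoˡ-≤ (A u x) (max x)) t
                                           (*-monoʳ-<-pos (ℕtoℚ (A u t)) {{ℕtoℚ-pos 0<Aut}} ft<fm) ⟩
      ∑ℚ (λ x → ℕtoℚ (A u x) * f m)   ≡⟨ ∑-edges-const u (f m) ⟩
      ℕtoℚ (deg A u) * f m            ≡⟨ cong (ℕtoℚ (deg A u) *_) (sym fu≡fm) ⟩
      ℕtoℚ (deg A u) * f u            ≡⟨ harm ⟩
      ∑ℚ (λ x → ℕtoℚ (A u x) * f x)   ∎))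
    where open ≤-Reasoning

  max-reach : ∀ {f m t} → IsMax f m → (∀ u → f u ≡ f m → Harmonic f u) →
              Reach A m t → f t ≡ f m
  max-reach max harm here = refl
  max-reach max harm (step r 0<A) =
    harmonic-max-neighbour max (harm _ fu≡fm) fu≡fm 0<A
    where fu≡fm = max-reach max harm r

module _ {A : Multigraph n} {s w : Fin n} {π : Fin n → ℚ} (hp : IsHittingProb A s w π) where

  private
    πs≡0 = let (e , _ , _) = hp in e
    πw≡1 = let (_ , e , _) = hp in e
    harmonic = let (_ , _ , e) = hp in e

  hittingProb≤1 : Connected A → ∀ u → π u ≤ 1ℚ
  hittingProb≤1 conn u with argmax s π
  ... | m , max with 1ℚ <? π m
  ...   | no  1≮πm = ≤-trans (max u) (≮⇒≥ 1≮πm)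
  ...   | yes 1<πm = contradiction (subst (1ℚ <ℚ_) πs≡0 1<πs) 1≮0
    where
    1≮0 : ¬ 1ℚ <ℚ 0ℚ
    1≮0 1<0 = <-asym 1<0 (positive⁻¹ 1ℚ)
    -- every vertex at the maximum level π m > 1 is neither the sink nor w
    max-level-harmonic : ∀ u → π u ≡ π m → Harmonic A π u
    max-level-harmonic u πu≡πm = harmonic u
      (λ { refl → 1≮0 (subst (1ℚ <ℚ_) (trans (sym πu≡πm) πs≡0) 1<πm) })
      (λ { refl → <-irrefl (trans (sym πw≡1) πu≡πm) 1<πm })
    1<πs : 1ℚ <ℚ π s
    1<πs = subst (1ℚ <ℚ_) (sym (max-reach A max max-level-harmonic (conn m s))) 1<πm

  hittingProb-superharmonic : Connected A → ∀ u → u ≢ s → Superharmonic A π u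
  hittingProb-superharmonic conn u u≢s with u ≟ w
  ... | no u≢w = ≤-reflexive (sym (harmonic u u≢s u≢w))
  ... | yes refl = begin
    ∑ℚ (λ t → ℕtoℚ (A u t) * π t)   ≤⟨ ∑ℚ-mono-≤ (λ t → ℕtoℚ-*-monoˡ-≤ (A u t)
                                                           (hittingProb≤1 conn t)) ⟩
    ∑ℚ (λ t → ℕtoℚ (A u t) * 1ℚ)    ≡⟨ ∑-edges-const A u 1ℚ ⟩
    ℕtoℚ (deg A u) * 1ℚ             ≡⟨ cong (ℕtoℚ (deg A u) *_) (sym πw≡1) ⟩
    ℕtoℚ (deg A u) * π u            ∎
    where open ≤-Reasoning

⟨_∣_⟩ : Config n → (Fin n → ℚ) → ℚ
⟨ c ∣ π ⟩ = ∑ℚ (λ u → ℕtoℚ (c u) * π u)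

⟨single∣⟩ : ∀ (v : Fin n) k π → ⟨ single v k ∣ π ⟩ ≡ ℕtoℚ k * π v
⟨single∣⟩ v k π = trans (∑ℚ-supported-at v _ off-v) (cong (λ z → ℕtoℚ z * π v) at-v)
  where
  at-v : single v k v ≡ k
  at-v with v ≟ v
  ... | yes _   = refl
  ... | no  v≢v = contradiction refl v≢v
  off-v : ∀ u → u ≢ v → ℕtoℚ (single v k u) * π u ≡ 0ℚ
  off-v u u≢v with u ≟ v
  ... | yes u≡v = contradiction u≡v u≢v
  ... | no  _   = *-zeroˡ (π u)

mutual
  weightedSum≡⟨∣⟩ : ∀ (s : Fin n) h π → π s ≡ 0ℚ → weightedSum s h π ≡ ⟨ h ∣ π ⟩
  weightedSum≡⟨∣⟩ s h π πs≡0 = ∑ℚ-cong (weightedSum-term s h π πs≡0)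

  -- The summand of weightedSum is local to its definition; its type is inferred from the use above.
  weightedSum-term : ∀ (s : Fin n) h π → π s ≡ 0ℚ → ∀ u → _ ≡ ℕtoℚ (h u) * π u
  weightedSum-term s h π πs≡0 u with u ≟ s
  ... | yes refl = sym (trans (cong (ℕtoℚ (h u) *_) πs≡0) (*-zeroʳ (ℕtoℚ (h u))))
  ... | no  _    = refl

topple-conserves : ∀ (A : Multigraph n) s u c → deg A u ℕ.≤ c u → ∀ v → v ≢ s →
                   topple A s u c v ℕ.+ single u (deg A u) v ≡ c v ℕ.+ A u v
topple-conserves A s u c d≤cu v v≢s with v ≟ s | v ≟ u
... | yes v≡s | _        = contradiction v≡s v≢s
... | no  _   | yes refl = ℕ.m∸n+n≡m (ℕ.≤-trans d≤cu (ℕ.m≤m+n (c v) (A v v)))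
... | no  _   | no  _    = ℕ.+-identityʳ _

module _ (A : Multigraph n) (s : Fin n) (π : Fin n → ℚ) (πs≡0 : π s ≡ 0ℚ) where

  ⟨topple∣⟩ : ∀ u c → deg A u ℕ.≤ c u →
              ⟨ topple A s u c ∣ π ⟩ + ℕtoℚ (deg A u) * π u
                ≡ ⟨ c ∣ π ⟩ + ∑ℚ (λ v → ℕtoℚ (A u v) * π v)
  ⟨topple∣⟩ u c d≤cu = begin
    ⟨ c′ ∣ π ⟩ + ℕtoℚ (deg A u) * π u
      ≡⟨ cong (⟨ c′ ∣ π ⟩ +_) (sym (⟨single∣⟩ u (deg A u) π)) ⟩
    ⟨ c′ ∣ π ⟩ + ⟨ single u (deg A u) ∣ π ⟩
      ≡⟨ sym (∑ℚ-+ (λ v → ℕtoℚ (c′ v) * π v) (λ v → ℕtoℚ (single u (deg A u) v) * π v)) ⟩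
    ∑ℚ (λ v → ℕtoℚ (c′ v) * π v + ℕtoℚ (single u (deg A u) v) * π v)
      ≡⟨ ∑ℚ-cong pointwise ⟩
    ∑ℚ (λ v → ℕtoℚ (c v) * π v + ℕtoℚ (A u v) * π v)
      ≡⟨ ∑ℚ-+ (λ v → ℕtoℚ (c v) * π v) (λ v → ℕtoℚ (A u v) * π v) ⟩
    ⟨ c ∣ π ⟩ + ∑ℚ (λ v → ℕtoℚ (A u v) * π v)
      ∎
    where
    open ≡-Reasoning
    c′ = topple A s u c
    scaled-by-zero : ∀ a b c d {p} → p ≡ 0ℚ → a * p + b * p ≡ c * p + d * p
    scaled-by-zero a b c d refl
      rewrite *-zeroʳ a | *-zeroʳ b | *-zeroʳ c | *-zeroʳ d = refl
    pointwise : ∀ v → ℕtoℚ (c′ v) * π v + ℕtoℚ (single u (deg A u) v) * π v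
                    ≡ ℕtoℚ (c v) * π v + ℕtoℚ (A u v) * π v
    pointwise v = by-cases (v ≟ s)
      where
      -- a plain case split: with-abstracting v ≟ s would also rewrite inside topple
      by-cases : Dec (v ≡ s) → ℕtoℚ (c′ v) * π v + ℕtoℚ (single u (deg A u) v) * π v
                                 ≡ ℕtoℚ (c v) * π v + ℕtoℚ (A u v) * π v
      by-cases (no v≢s)  = ℕtoℚ-+-scaled (c′ v) (single u (deg A u) v) (c v) (A u v) (π v)
                              (topple-conserves A s u c d≤cu v v≢s)
      by-cases (yes refl) = scaled-by-zero (ℕtoℚ (c′ v)) (ℕtoℚ (single u (deg A u) v))
                                              (ℕtoℚ (c v)) (ℕtoℚ (A u v)) πs≡0

  module _ (super : ∀ u → u ≢ s → Superharmonic A π u) where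

    topple-⟨∣⟩-antitone : ∀ {u c} → u ≢ s → deg A u ℕ.≤ c u → ⟨ topple A s u c ∣ π ⟩ ≤ ⟨ c ∣ π ⟩
    topple-⟨∣⟩-antitone {u} {c} u≢s d≤cu = +-cancelʳ-≤ (ℕtoℚ (deg A u) * π u) (begin
      ⟨ topple A s u c ∣ π ⟩ + ℕtoℚ (deg A u) * π u   ≡⟨ ⟨topple∣⟩ u c d≤cu ⟩
      ⟨ c ∣ π ⟩ + ∑ℚ (λ v → ℕtoℚ (A u v) * π v)       ≤⟨ +-monoʳ-≤ ⟨ c ∣ π ⟩ (super u u≢s) ⟩
      ⟨ c ∣ π ⟩ + ℕtoℚ (deg A u) * π u                ∎)
      where open ≤-Reasoning

    legal-⟨∣⟩-antitone : ∀ {c us c′} → Legal A s c us c′ → ⟨ c′ ∣ π ⟩ ≤ ⟨ c ∣ π ⟩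
    legal-⟨∣⟩-antitone done                 = ≤-refl
    legal-⟨∣⟩-antitone (top u≢s d≤cu rest) =
      ≤-trans (legal-⟨∣⟩-antitone rest) (topple-⟨∣⟩-antitone u≢s d≤cu)

lemma11 : (n : ℕ) (A : Multigraph n) (s : Fin n) →
          Symmetric A → Connected A →
          (v w : Fin n) → v ≢ s → w ≢ s →
          (π : Fin n → ℚ) → IsHittingProb A s w π → 0ℚ <ℚ π v →
          (x : ℕ) → ToppleDuring A s (single v x) w →
          (∀ y → y < x → ¬ ToppleDuring A s (single v y) w) →
          (us : List (Fin n)) (h : Config n) → RelaxesVia A s (single v x) us h →
          weightedSum s h π ≤ ℕtoℚ x * π v
lemma11 n A s _ conn v _ _ _ π hp@(πs≡0 , _) _ x _ _ _ h (legal , _) = begin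
  weightedSum s h π     ≡⟨ weightedSum≡⟨∣⟩ s h π πs≡0 ⟩
  ⟨ h ∣ π ⟩             ≤⟨ legal-⟨∣⟩-antitone A s π πs≡0
                             (hittingProb-superharmonic hp conn) legal ⟩
  ⟨ single v x ∣ π ⟩    ≡⟨ ⟨single∣⟩ v x π ⟩
  ℕtoℚ x * π v          ∎
  where open ≤-Reasoning
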